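{- Let $r\geq 6$ and $3\leq j\leq r-3$ be integers. Then $(r-j)^{r-j}j^j<(r-1)^{r-1}$. -}

module Defs where

{-# OPTIONS --safe #-}
-- n ↦ n ^ n is strictly log-convex, by Bernoulli's inequality. Hence the ratio
-- g (n + 1) / g n of g n = (n + 1) ^ (n + 1) strictly increases, and multiplying these ratios
-- shows g a * g b < g (a + b) * g 0 for a, b ≥ 1; with g 0 = 1 and a = r - j - 1, b = j - 1 this
-- is the claim.
module Submission where

open import Defs
open import Data.Nat using (ℕ; _∸_; _^_; _*_; _≤_; _<_)
open import Data.Nat.Base using (zero; suc; _+_; z≤n; s≤s; z<s)
open import Data.Nat.Properties
open import Data.Sum using (inj₁; inj₂)
open import Relation.Binary.PropositionalEquality
open import Data.Nat.Tactic.RingSolver using (solve-∀)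

^-distribʳ-* : ∀ m n o → (m * n) ^ o ≡ m ^ o * n ^ o
^-distribʳ-* m n zero    = refl
^-distribʳ-* m n (suc o) = begin
  m * n * (m * n) ^ o      ≡⟨ cong (m * n *_) (^-distribʳ-* m n o) ⟩
  m * n * (m ^ o * n ^ o)  ≡⟨ [m*n]*[o*p]≡[m*o]*[n*p] m n (m ^ o) (n ^ o) ⟩
  m * m ^ o * (n * n ^ o)  ∎
  where open ≡-Reasoning

-- Bernoulli's inequality (1 - 1/(y+1)) ^ k ≥ 1 - k/(y+1), cleared of denominators.
bernoulli : ∀ y k → suc y ^ k * suc y ≤ y ^ k * suc y + k * suc y ^ k
bernoulli y zero    = m≤m+n (suc y + 0) 0
bernoulli y (suc k) = begin
  suc y ^ suc k * suc y                         ≡⟨ *-assoc (suc y) (suc y ^ k) (suc y) ⟩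
  suc y * (suc y ^ k * suc y)                   ≤⟨ *-monoʳ-≤ (suc y) (bernoulli y k) ⟩
  suc y * (y ^ k * suc y + k * suc y ^ k)       ≡⟨ expand y (y ^ k) k (suc y ^ k) ⟩
  y ^ suc k * suc y + (y ^ k * suc y + k * suc y ^ suc k)
    ≤⟨ +-monoʳ-≤ (y ^ suc k * suc y) (+-monoˡ-≤ (k * suc y ^ suc k) yᵏ[1+y]≤[1+y]ᵏ⁺¹) ⟩
  y ^ suc k * suc y + suc k * suc y ^ suc k     ∎
  where
  open ≤-Reasoning
  expand : ∀ y A k C → suc y * (A * suc y + k * C) ≡ y * A * suc y + (A * suc y + k * (suc y * C))
  expand = solve-∀
  yᵏ[1+y]≤[1+y]ᵏ⁺¹ : y ^ k * suc y ≤ suc y ^ suc k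
  yᵏ[1+y]≤[1+y]ᵏ⁺¹ = begin
    y ^ k * suc y      ≡⟨ *-comm (y ^ k) (suc y) ⟩
    suc y * y ^ k      ≤⟨ *-monoʳ-≤ (suc y) (^-monoˡ-≤ k (n≤1+n y)) ⟩
    suc y * suc y ^ k  ∎

n^n-logConvex : ∀ n → suc n ^ suc n * suc n ^ suc n < suc (suc n) ^ suc (suc n) * n ^ n
n^n-logConvex zero      = s≤s (s≤s z≤n)
n^n-logConvex n@(suc _) = *-cancelˡ-< n _ _ (begin-strict
  n * (suc n ^ suc n * suc n ^ suc n)   ≡⟨ cong (n *_) (sym (^-distribʳ-* (suc n) (suc n) (suc n))) ⟩
  n * (suc n * suc n) ^ suc n           ≡⟨ cong (λ x → n * x ^ suc n) (square n) ⟩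
  n * suc y ^ suc n                     ≤⟨ bernoulli-bound ⟩
  suc n * y ^ suc n                     <⟨ +-monoˡ-< (suc n * y ^ suc n) (m^n>0 y (suc n)) ⟩
  suc (suc n) * y ^ suc n               ≡⟨ cong (suc (suc n) *_) (^-distribʳ-* n (suc (suc n)) (suc n)) ⟩
  suc (suc n) * (n * n ^ n * (suc (suc n) * suc (suc n) ^ n))
                                        ≡⟨ rearrange n (n ^ n) (suc (suc n) ^ n) ⟩
  n * (suc (suc n) ^ suc (suc n) * n ^ n) ∎)
  where
  open ≤-Reasoning
  -- With y = n (n + 2) we have (n + 1)² = y + 1 and n ^ n (n + 2) ^ (n + 2) = y ^ (n + 1) (n + 2) / n,
  -- so the claim is ((y + 1) / y) ^ (n + 1) < (n + 2) / n, and Bernoulli even gives ≤ (n + 1) / n.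
  y : ℕ
  y = n * suc (suc n)
  square : ∀ n → suc n * suc n ≡ suc (n * suc (suc n))
  square = solve-∀
  rearrange : ∀ n A B → suc (suc n) * (n * A * (suc (suc n) * B)) ≡ n * (suc (suc n) * (suc (suc n) * B) * A)
  rearrange = solve-∀
  bernoulli-bound : n * suc y ^ suc n ≤ suc n * y ^ suc n
  bernoulli-bound = *-cancelʳ-≤ _ _ (suc n) (+-cancelʳ-≤ (suc n * suc y ^ suc n) _ _ (begin
    n * suc y ^ suc n * suc n + suc n * suc y ^ suc n  ≡⟨ left n (suc y ^ suc n) ⟩
    suc y ^ suc n * suc y                               ≤⟨ bernoulli y (suc n) ⟩
    y ^ suc n * suc y + suc n * suc y ^ suc n           ≡⟨ right n (y ^ suc n) (suc y ^ suc n) ⟩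
    suc n * y ^ suc n * suc n + suc n * suc y ^ suc n   ∎))
    where
    left : ∀ n Q → n * Q * suc n + suc n * Q ≡ Q * suc (n * suc (suc n))
    left = solve-∀
    right : ∀ n Y Q → Y * suc (n * suc (suc n)) + suc n * Q ≡ suc n * Y * suc n + suc n * Q
    right = solve-∀

-- Comparison of fractions by cross-multiplication; a record rather than a synonym so that
-- the four numbers can be inferred from it.
infix 4 _/_<_/_
record _/_<_/_ (a b c d : ℕ) : Set where
  constructor cross
  field uncross : a * d < c * b

open _/_<_/_

ratio-<-trans : ∀ {a b c d e g} → a / b < c / d → c / d < e / g → a / b < e / g
ratio-<-trans {a} {b} {c} {d} {e} {g} (cross ad<cb) (cross cg<ed) = cross (*-cancelʳ-< (c * d) _ _ (begin-strict
  a * g * (c * d)  ≡⟨ left a g c d ⟩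
  a * d * (c * g)  <⟨ *-mono-< ad<cb cg<ed ⟩
  c * b * (e * d)  ≡⟨ right c b e d ⟩
  e * b * (c * d)  ∎))
  where
  open ≤-Reasoning
  left : ∀ a g c d → a * g * (c * d) ≡ a * d * (c * g)
  left = solve-∀
  right : ∀ c b e d → c * b * (e * d) ≡ e * b * (c * d)
  right = solve-∀

ratio-<-* : ∀ {a b c d e g} → a / b < c / d → b / e < d / g → a / e < c / g
ratio-<-* {a} {b} {c} {d} {e} {g} (cross ad<cb) (cross bg<de) = cross (*-cancelʳ-< (b * d) _ _ (begin-strict
  a * g * (b * d)  ≡⟨ left a g b d ⟩
  a * d * (b * g)  <⟨ *-mono-< ad<cb bg<de ⟩
  c * b * (d * e)  ≡⟨ right c b d e ⟩
  c * e * (b * d)  ∎))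
  where
  open ≤-Reasoning
  left : ∀ a g b d → a * g * (b * d) ≡ a * d * (b * g)
  left = solve-∀
  right : ∀ c b d e → c * b * (d * e) ≡ c * e * (b * d)
  right = solve-∀

module LogConvex (f : ℕ → ℕ) (logConvex : ∀ n → f (suc n) / f n < f (suc (suc n)) / f (suc n)) where

  ratio-< : ∀ {m n} → m < n → f (suc m) / f m < f (suc n) / f n
  ratio-< {m} {suc n} (s≤s m≤n) with m≤n⇒m<n∨m≡n m≤n
  ... | inj₁ m<n  = ratio-<-trans (ratio-< m<n) (logConvex n)
  ... | inj₂ refl = logConvex m

  supermultiplicative : ∀ a {b} → 0 < b → f (suc a) / f 0 < f (suc a + b) / f b
  supermultiplicative zero    0<b = ratio-< 0<b
  supermultiplicative (suc a) 0<b = ratio-<-* (ratio-< (m<m+n (suc a) 0<b)) (supermultiplicative a 0<b)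

open LogConvex (λ n → suc n ^ suc n) (λ n → cross (n^n-logConvex (suc n)))

m^m*n^n<[m+n∸1]^[m+n∸1] : ∀ {m n} → 2 ≤ m → 2 ≤ n → m ^ m * n ^ n < (m + n ∸ 1) ^ (m + n ∸ 1)
m^m*n^n<[m+n∸1]^[m+n∸1] {suc (suc a)} {suc (suc b)} (s≤s (s≤s _)) (s≤s (s≤s _)) = begin-strict
  suc (suc a) ^ suc (suc a) * suc (suc b) ^ suc (suc b)   <⟨ uncross (supermultiplicative a z<s) ⟩
  suc (suc a + suc b) ^ suc (suc a + suc b) * 1            ≡⟨ *-identityʳ _ ⟩
  suc (suc a + suc b) ^ suc (suc a + suc b)                ≡⟨ cong (λ k → k ^ k) (cong suc (sym (+-suc a (suc b)))) ⟩
  suc (a + suc (suc b)) ^ suc (a + suc (suc b))            ∎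
  where open ≤-Reasoning

lemma1 : (r j : ℕ) → 6 ≤ r → 3 ≤ j → j ≤ r ∸ 3 →
    (r ∸ j) ^ (r ∸ j) * j ^ j < (r ∸ 1) ^ (r ∸ 1)
lemma1 r j 6≤r 3≤j j≤r∸3 =
  subst (λ n → (r ∸ j) ^ (r ∸ j) * j ^ j < (n ∸ 1) ^ (n ∸ 1)) (m∸n+n≡m j≤r)
    (m^m*n^n<[m+n∸1]^[m+n∸1] 2≤r∸j (≤-trans (n≤1+n 2) 3≤j))
  where
  3+j≤r : 3 + j ≤ r
  3+j≤r = subst (_≤ r) (+-comm j 3) (m≤o∸n⇒m+n≤o j (m+n≤o⇒m≤o 3 6≤r) j≤r∸3)
  j≤r : j ≤ r
  j≤r = m+n≤o⇒n≤o 3 3+j≤r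
  2≤r∸j : 2 ≤ r ∸ j
  2≤r∸j = m+n≤o⇒m≤o∸n 2 (<⇒≤ 3+j≤r)
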